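{- Let $G=(K\cup S,E)$ be a split graph. If $\omega(G)\geq 3$ or if $G$ is a star, then $\chi_{\text{lid}}(G)\leq 2\omega(G)-1$.
   Context: A split graph is a graph $G=(K\cup S,E)$ whose vertex set is partitioned into a clique $K$ and an independent set $S$ (the partition is taken with $K$ of maximum size). $\omega(G)$ is the clique number. A star is a graph $K_{1,n}$. For a vertex $u$, $N[u]$ is its closed neighborhood; for a coloring $c$ and vertex set $S'$, $c(S')$ is the set of colors on $S'$. A lid-coloring of $G$ is a proper vertex-coloring $c$ such that for every edge $uv$ with $N[u]\neq N[v]$, $c(N[u])\neq c(N[v])$; $\chi_{\text{lid}}(G)$ is the minimum number of colors in a lid-coloring of $G$. -}

module Defs where

open import Data.Nat using (ℕ; _≤_)
open import Data.Fin using (Fin)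
open import Data.Fin.Subset using (Subset; _∈_; _∉_; ∣_∣)
open import Data.Product using (Σ; ∃; _×_)
open import Data.Sum using (_⊎_)
open import Relation.Nullary using (¬_; Dec)
open import Relation.Binary.PropositionalEquality using (_≡_; _≢_)
open import Function.Bundles using (_⇔_)

record Graph (n : ℕ) : Set₁ where
  field
    Adj     : Fin n → Fin n → Set
    adj?    : ∀ u v → Dec (Adj u v)
    sym     : ∀ {u v} → Adj u v → Adj v u
    irrefl  : ∀ {u} → ¬ Adj u u
open Graph public

module _ {n : ℕ} (G : Graph n) where

  InClosedNbhd : Fin n → Fin n → Set
  InClosedNbhd u w = (w ≡ u) ⊎ Adj G u w

  IsClique : Subset n → Set
  IsClique K = ∀ u v → u ∈ K → v ∈ K → u ≢ v → Adj G u v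

  IsIndependent : (Fin n → Set) → Set
  IsIndependent S = ∀ u v → S u → S v → ¬ Adj G u v

  IsSplit : Set
  IsSplit = ∃ λ (K : Subset n) → IsClique K × IsIndependent (λ v → v ∉ K)

  IsCliqueNumber : ℕ → Set
  IsCliqueNumber w = (∃ λ K → IsClique K × ∣ K ∣ ≡ w)
                   × (∀ K → IsClique K → ∣ K ∣ ≤ w)

  IsStar : Set
  IsStar = ∃ λ (z : Fin n) → ∀ u v → (Adj G u v ⇔ ((u ≡ z ⊎ v ≡ z) × u ≢ v))

  ColorsOfClosedNbhd : {k : ℕ} → (Fin n → Fin k) → Fin n → Fin k → Set
  ColorsOfClosedNbhd c u x = ∃ λ w → InClosedNbhd u w × c w ≡ x

  IsProperColoring : {k : ℕ} → (Fin n → Fin k) → Set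
  IsProperColoring c = ∀ u v → Adj G u v → c u ≢ c v

  IsLidColoring : {k : ℕ} → (Fin n → Fin k) → Set
  IsLidColoring c = IsProperColoring c ×
    (∀ u v → Adj G u v →
       ¬ (∀ w → InClosedNbhd u w ⇔ InClosedNbhd v w) →
       ¬ (∀ x → ColorsOfClosedNbhd c u x ⇔ ColorsOfClosedNbhd c v x))

  LidChromaticAtMost : ℕ → Set
  LidChromaticAtMost k = ∃ λ (c : Fin n → Fin k) → IsLidColoring c

module Submission where

-- Let k = |K| ≤ w.  The clique vertices get the colours 0, …, k − 1 (their
-- rank).  A greedy pass over S (GreedySeparator) selects vertices that split
-- two clique vertices not yet told apart by the earlier selections; the
-- selected set T tells apart all clique vertices with different neighbourhoods
-- in S, and each t ∈ T has a witness, the least vertex of the class it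
-- creates, which is injective and never the first clique vertex.  So T gets at
-- most k − 1 private colours, and these separate every edge inside K
-- (SplitGraph.Scheme).  The edges between K and S are separated by the choice
-- of colours on S ∖ T: with the extra colours k and k + 1 when k < w (CaseA),
-- and with the colour of a missed clique vertex when k = w ≥ 3 (CaseB), where
-- the pass examines the vertices missing a single clique vertex first.  A star
-- is CaseA for K = {centre}, unless it has no edges.

open import Defs
open import Data.Nat using (ℕ; _≤_; _*_; _∸_; zero; suc; _+_; _<_; z≤n; s≤s; pred; _<?_; _≤?_)
import Data.Nat as ℕ
open import Data.Nat.Properties hiding (0≢1+n; suc-injective)
open import Data.Bool using (Bool; true; false; _∧_; _∨_; if_then_else_)
import Data.Bool.Properties as Bool
open import Data.Fin as Fin using (Fin; toℕ; fromℕ<)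
open import Data.Fin.Properties using (toℕ-injective; toℕ<n; toℕ-fromℕ<; suc-injective; 0≢1+n; any?; all?; ¬∀⟶∃¬)
open import Data.Fin.Subset using (Subset; _∈_; _∉_; ∣_∣; ⁅_⁆)
open import Data.Fin.Subset.Properties using (∣⁅x⁆∣≡1; x∈⁅y⁆⇒x≡y; x∈⁅x⁆)
open import Data.Vec using (lookup; tabulate; _∷_; [])
open import Data.Vec.Properties using ([]=⇒lookup; lookup⇒[]=; lookup∘tabulate)
open import Data.Product using (_×_; Σ; ∃; _,_; proj₁; proj₂)
open import Data.Sum using (_⊎_; inj₁; inj₂)
open import Data.Empty using (⊥-elim)
open import Function.Base using (_∘_)
open import Function.Bundles using (_⇔_; mk⇔; Equivalence)
open import Relation.Nullary using (¬_; Dec; yes; no; does)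
open import Relation.Nullary.Decidable using (dec-true; dec-false; _×-dec_; _→-dec_; ¬?)
open import Relation.Binary using (tri<; tri≈; tri>)
open import Relation.Binary.PropositionalEquality
  using (_≡_; _≢_; refl; trans; cong; cong₂; subst; subst₂; module ≡-Reasoning)
  renaming (sym to ≡-sym)
open import Algebra.Properties.CommutativeSemigroup +-commutativeSemigroup using (interchange)

module BoolFacts where

  true≢false : true ≢ false
  true≢false ()

  bool-cases : ∀ b → b ≡ true ⊎ b ≡ false
  bool-cases true = inj₁ refl
  bool-cases false = inj₂ refl

  does-true : ∀ {P : Set} (d : Dec P) → does d ≡ true → P
  does-true (yes p) _ = p

  does-false : ∀ {P : Set} (d : Dec P) → does d ≡ false → ¬ P
  does-false (no ¬p) _ = ¬p

  ∧-true : ∀ {a b} → a ∧ b ≡ true → a ≡ true × b ≡ true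
  ∧-true {true} e = refl , e

  ∧-intro : ∀ {a b} → a ≡ true → b ≡ true → a ∧ b ≡ true
  ∧-intro refl refl = refl

  ∨-true : ∀ {a b} → a ∨ b ≡ true → a ≡ true ⊎ b ≡ true
  ∨-true {true} _ = inj₁ refl
  ∨-true {false} e = inj₂ e

  ∨-introˡ : ∀ {a b} → a ≡ true → a ∨ b ≡ true
  ∨-introˡ refl = refl

  ∨-introʳ : ∀ {a b} → b ≡ true → a ∨ b ≡ true
  ∨-introʳ {a} refl = Bool.∨-zeroʳ a

open BoolFacts

module Counting where

  bit : Bool → ℕ
  bit true = 1
  bit false = 0

  count : ∀ {n} → (Fin n → Bool) → ℕ
  count {zero} f = 0
  count {suc n} f = bit (f Fin.zero) + count (f ∘ Fin.suc)

  private
    bit-mono : ∀ {a b} → (a ≡ true → b ≡ true) → bit a ≤ bit b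
    bit-mono {false} h = z≤n
    bit-mono {true} h rewrite h refl = ≤-refl

    bit≤1 : ∀ b → bit b ≤ 1
    bit≤1 true = ≤-refl
    bit≤1 false = z≤n

    bit-union : ∀ a b c → (a ≡ true → b ≡ true ⊎ c ≡ true) → bit a ≤ bit b + bit c
    bit-union false b c h = z≤n
    bit-union true true c h = s≤s z≤n
    bit-union true false true h = s≤s z≤n
    bit-union true false false h with h refl
    ... | inj₁ ()
    ... | inj₂ ()

  count-cong : ∀ {n} (f g : Fin n → Bool) → (∀ i → f i ≡ g i) → count f ≡ count g
  count-cong {zero} f g e = refl
  count-cong {suc n} f g e = cong₂ _+_ (cong bit (e Fin.zero)) (count-cong (f ∘ Fin.suc) (g ∘ Fin.suc) (e ∘ Fin.suc))

  count-mono : ∀ {n} (f g : Fin n → Bool) → (∀ i → f i ≡ true → g i ≡ true) → count f ≤ count g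
  count-mono {zero} f g h = z≤n
  count-mono {suc n} f g h = +-mono-≤ (bit-mono (h Fin.zero)) (count-mono (f ∘ Fin.suc) (g ∘ Fin.suc) (h ∘ Fin.suc))

  count-strict : ∀ {n} (f g : Fin n → Bool) → (∀ i → f i ≡ true → g i ≡ true) →
                 ∀ j → g j ≡ true → f j ≡ false → count f < count g
  count-strict {suc n} f g h Fin.zero gj fj rewrite gj | fj =
    s≤s (count-mono (f ∘ Fin.suc) (g ∘ Fin.suc) (h ∘ Fin.suc))
  count-strict {suc n} f g h (Fin.suc j) gj fj =
    +-mono-≤-< (bit-mono (h Fin.zero)) (count-strict (f ∘ Fin.suc) (g ∘ Fin.suc) (h ∘ Fin.suc) j gj fj)

  count-positive : ∀ {n} (f : Fin n → Bool) j → f j ≡ true → 1 ≤ count f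
  count-positive {suc n} f Fin.zero fj rewrite fj = s≤s z≤n
  count-positive {suc n} f (Fin.suc j) fj = ≤-trans (count-positive (f ∘ Fin.suc) j fj) (m≤n+m _ (bit (f Fin.zero)))

  count-none : ∀ {n} (f : Fin n → Bool) → (∀ i → f i ≢ true) → count f ≡ 0
  count-none {zero} f h = refl
  count-none {suc n} f h with f Fin.zero in e
  ... | true = ⊥-elim (h Fin.zero e)
  ... | false = count-none (f ∘ Fin.suc) (h ∘ Fin.suc)

  count-single : ∀ {n} (f : Fin n → Bool) x → (∀ i → f i ≡ true → i ≡ x) → count f ≤ 1
  count-single {suc n} f Fin.zero h
    rewrite count-none (f ∘ Fin.suc) (λ i p → 0≢1+n (≡-sym (h (Fin.suc i) p))) | +-identityʳ (bit (f Fin.zero)) =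
      bit≤1 (f Fin.zero)
  count-single {suc n} f (Fin.suc x) h with f Fin.zero in e
  ... | true = ⊥-elim (0≢1+n (h Fin.zero e))
  ... | false = count-single (f ∘ Fin.suc) x (λ i p → suc-injective (h (Fin.suc i) p))

  count-union : ∀ {n} (f g h : Fin n → Bool) → (∀ i → f i ≡ true → g i ≡ true ⊎ h i ≡ true) →
                count f ≤ count g + count h
  count-union {zero} f g h k = z≤n
  count-union {suc n} f g h k = begin
    bit (f Fin.zero) + count (f ∘ Fin.suc)
      ≤⟨ +-mono-≤ (bit-union (f Fin.zero) (g Fin.zero) (h Fin.zero) (k Fin.zero))
                  (count-union (f ∘ Fin.suc) (g ∘ Fin.suc) (h ∘ Fin.suc) (k ∘ Fin.suc)) ⟩
    (bit (g Fin.zero) + bit (h Fin.zero)) + (count (g ∘ Fin.suc) + count (h ∘ Fin.suc))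
      ≡⟨ interchange (bit (g Fin.zero)) (bit (h Fin.zero)) (count (g ∘ Fin.suc)) (count (h ∘ Fin.suc)) ⟩
    count g + count h ∎
    where open ≤-Reasoning

  ∣∣≡count : ∀ {n} (p : Subset n) → ∣ p ∣ ≡ count (lookup p)
  ∣∣≡count [] = refl
  ∣∣≡count (true ∷ p) = cong suc (∣∣≡count p)
  ∣∣≡count (false ∷ p) = ∣∣≡count p

open Counting

module Choice where

  choose : ∀ {n} {P : Fin n → Set} → Dec (∃ P) → Fin n → Fin n
  choose (yes (x , _)) d = x
  choose (no _) d = d

  choose-spec : ∀ {n} {P : Fin n → Set} (d : Dec (∃ P)) (default : Fin n) → ∃ P → P (choose d default)
  choose-spec (yes (x , px)) _ _ = px
  choose-spec (no ¬p) _ e = ⊥-elim (¬p e)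

  least : ∀ {n} (P : Fin n → Set) → (∀ i → Dec (P i)) → ∀ s → P s →
          Σ (Fin n) λ s₀ → P s₀ × (∀ s' → P s' → toℕ s₀ ≤ toℕ s')
  least {suc n} P P? s ps with P? Fin.zero
  ... | yes p0 = Fin.zero , p0 , (λ _ _ → z≤n)
  least {suc n} P P? Fin.zero ps | no ¬p0 = ⊥-elim (¬p0 ps)
  least {suc n} P P? (Fin.suc s) ps | no ¬p0 with least (P ∘ Fin.suc) (P? ∘ Fin.suc) s ps
  ... | s₀ , p₀ , min = Fin.suc s₀ , p₀ , λ { Fin.zero q → ⊥-elim (¬p0 q) ; (Fin.suc s') q → s≤s (min s' q) }

open Choice

-- A sufficient condition for a lid-colouring, phrased for colourings into ℕ:
-- an edge uv is separated when N[u] carries a colour absent from N[v] (or vice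
-- versa), or when N[u] = N[v].
module LidCriterion {n : ℕ} (G : Graph n) (col : Fin n → ℕ) where

  PrivateColour : Fin n → Fin n → Set
  PrivateColour u v = ∃ λ w → InClosedNbhd G u w × ∀ w' → InClosedNbhd G v w' → col w' ≢ col w

  Separated : Fin n → Fin n → Set
  Separated u v = PrivateColour u v ⊎ PrivateColour v u ⊎ (∀ w → InClosedNbhd G u w ⇔ InClosedNbhd G v w)

  separated-sym : ∀ {u v} → Separated u v → Separated v u
  separated-sym (inj₁ p) = inj₂ (inj₁ p)
  separated-sym (inj₂ (inj₁ p)) = inj₁ p
  separated-sym (inj₂ (inj₂ h)) = inj₂ (inj₂ λ w → mk⇔ (Equivalence.from (h w)) (Equivalence.to (h w)))

  lid-colouring : ∀ {N} → (∀ v → col v < N) → (∀ u v → Adj G u v → col u ≢ col v) →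
                  (∀ u v → Adj G u v → Separated u v) → LidChromaticAtMost G N
  lid-colouring {N} bounded proper separated = c , proper-c , lid
    where
      c : Fin n → Fin N
      c v = fromℕ< (bounded v)

      c-reflects : ∀ {u v} → c u ≡ c v → col u ≡ col v
      c-reflects {u} {v} e = begin
        col u             ≡⟨ ≡-sym (toℕ-fromℕ< (bounded u)) ⟩
        toℕ (c u)         ≡⟨ cong toℕ e ⟩
        toℕ (c v)         ≡⟨ toℕ-fromℕ< (bounded v) ⟩
        col v             ∎
        where open ≡-Reasoning

      proper-c : IsProperColoring G c
      proper-c u v a e = proper u v a (c-reflects e)

      no-private : ∀ {u v} → (∀ x → ColorsOfClosedNbhd G c u x → ColorsOfClosedNbhd G c v x) →
                   ¬ PrivateColour u v
      no-private sub (w , w∈Nu , unseen) with sub (c w) (w , w∈Nu , refl)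
      ... | w' , w'∈Nv , e = unseen w' w'∈Nv (c-reflects e)

      lid : ∀ u v → Adj G u v → ¬ (∀ w → InClosedNbhd G u w ⇔ InClosedNbhd G v w) →
            ¬ (∀ x → ColorsOfClosedNbhd G c u x ⇔ ColorsOfClosedNbhd G c v x)
      lid u v a N≠ c= with separated u v a
      ... | inj₁ p = no-private (λ x → Equivalence.to (c= x)) p
      ... | inj₂ (inj₁ p) = no-private (λ x → Equivalence.from (c= x)) p
      ... | inj₂ (inj₂ N=) = N≠ N=

edgeless-lid : ∀ {n N} (G : Graph n) → (∀ u v → ¬ Adj G u v) → 0 < N → LidChromaticAtMost G N
edgeless-lid G no-edge 0<N =
  (λ _ → fromℕ< 0<N) , (λ u v a → ⊥-elim (no-edge u v a)) , (λ u v a → ⊥-elim (no-edge u v a))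

module CliqueBound {n : ℕ} (G : Graph n) (w : ℕ) (ω≡w : IsCliqueNumber G w) where

  PairwiseAdjacent : (Fin n → Bool) → Set
  PairwiseAdjacent f = ∀ u v → f u ≡ true → f v ≡ true → u ≢ v → Adj G u v

  clique-count≤ω : ∀ f → PairwiseAdjacent f → count f ≤ w
  clique-count≤ω f adj = subst (_≤ w) size (proj₂ ω≡w (tabulate f) clique)
    where
      member : ∀ {u} → u ∈ tabulate f → f u ≡ true
      member {u} p = trans (≡-sym (lookup∘tabulate f u)) ([]=⇒lookup p)
      clique : IsClique G (tabulate f)
      clique u v pu pv = adj u v (member pu) (member pv)
      size : ∣ tabulate f ∣ ≡ count f
      size = trans (∣∣≡count (tabulate f)) (count-cong _ f (lookup∘tabulate f))

  clique-extension<ω : ∀ f → PairwiseAdjacent f → ∀ s → f s ≡ false → (∀ u → f u ≡ true → Adj G s u) →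
                       count f < w
  clique-extension<ω f adj s fs≡false s-sees-f =
    <-≤-trans (count-strict f f+s (λ i → ∨-introˡ) s (∨-introʳ (dec-true (s Fin.≟ s) refl)) fs≡false)
              (clique-count≤ω f+s adj+s)
    where
      f+s : Fin n → Bool
      f+s i = f i ∨ does (i Fin.≟ s)
      member : ∀ {u} → f+s u ≡ true → f u ≡ true ⊎ u ≡ s
      member {u} p with ∨-true p
      ... | inj₁ fu = inj₁ fu
      ... | inj₂ u≡s = inj₂ (does-true (u Fin.≟ s) u≡s)
      adj+s : PairwiseAdjacent f+s
      adj+s u v pu pv u≢v with member pu | member pv
      ... | inj₁ fu | inj₁ fv = adj u v fu fv u≢v
      ... | inj₁ fu | inj₂ refl = sym G (s-sees-f u fu)
      ... | inj₂ refl | inj₁ fv = s-sees-f v fv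
      ... | inj₂ refl | inj₂ refl = ⊥-elim (u≢v refl)

  vertex⇒1≤ω : Fin n → 1 ≤ w
  vertex⇒1≤ω z = subst (_< w) (count-none nothing (λ _ ())) (clique-extension<ω nothing (λ _ _ ()) z refl (λ _ ()))
    where
      nothing : Fin n → Bool
      nothing _ = false

  edge⇒2≤ω : ∀ {u v} → Adj G u v → 2 ≤ w
  edge⇒2≤ω {u} {v} u~v = <-≤-trans (s≤s (count-positive is-u u (dec-true (u Fin.≟ u) refl)))
                           (clique-extension<ω is-u single v v∉ v-sees)
    where
      is-u : Fin n → Bool
      is-u i = does (i Fin.≟ u)
      single : PairwiseAdjacent is-u
      single x y px py x≢y = ⊥-elim (x≢y (trans (does-true (x Fin.≟ u) px) (≡-sym (does-true (y Fin.≟ u) py))))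
      v∉ : is-u v ≡ false
      v∉ = dec-false (v Fin.≟ u) (λ { refl → irrefl G u~v })
      v-sees : ∀ x → is-u x ≡ true → Adj G v x
      v-sees x px rewrite does-true (x Fin.≟ u) px = sym G u~v

-- Points are the indices satisfying inP; every
-- other index t is a test, and test u t says whether point u passes t.  Tests
-- are examined one at a time in increasing priority; a test is selected when
-- it splits two points that the tests selected so far do not distinguish.
-- The selected tests distinguish every two points that any test distinguishes,
-- and each selected test t creates a new trace class whose least point
-- witness t is never the least point overall; witness is injective, so the
-- selected tests are indexed by points other than the first one.
module GreedySeparator {n : ℕ} (inP : Fin n → Bool) (test : Fin n → Fin n → Bool)
                       (priority : Fin n → ℕ) (M : ℕ)
                       (priority-injective : ∀ {s t} → priority s ≡ priority t → s ≡ t)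
                       (priority<M : ∀ t → priority t < M) where

  SameTrace : (Fin n → Bool) → Fin n → Fin n → Set
  SameTrace X u v = ∀ t → X t ≡ true → test u t ≡ test v t

  sameTrace? : ∀ X u v → Dec (SameTrace X u v)
  sameTrace? X u v = all? (λ t → (X t Bool.≟ true) →-dec (test u t Bool.≟ test v t))

  sameTrace-trans : ∀ {X u v w} → SameTrace X u v → SameTrace X v w → SameTrace X u w
  sameTrace-trans p q t x = trans (p t x) (q t x)

  sameTrace-sym : ∀ {X u v} → SameTrace X u v → SameTrace X v u
  sameTrace-sym p t x = ≡-sym (p t x)

  sameTrace-restrict : ∀ {X Y u v} → (∀ t → X t ≡ true → Y t ≡ true) → SameTrace Y u v → SameTrace X u v
  sameTrace-restrict X⊆Y p t x = p t (X⊆Y t x)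

  Splits : (Fin n → Bool) → Fin n → Set
  Splits X t = inP t ≡ false ×
               ∃ λ u → ∃ λ v → inP u ≡ true × inP v ≡ true × SameTrace X u v × test u t ≢ test v t

  splits? : ∀ X t → Dec (Splits X t)
  splits? X t = (inP t Bool.≟ false) ×-dec any? (λ u → any? (λ v →
    (inP u Bool.≟ true) ×-dec (inP v Bool.≟ true) ×-dec sameTrace? X u v ×-dec ¬? (test u t Bool.≟ test v t)))

  stage : ℕ → Fin n → Bool
  stage zero t = false
  stage (suc m) t = stage m t ∨ (does (priority t ℕ.≟ m) ∧ does (splits? (stage m) t))

  selected : Fin n → Bool
  selected = stage M

  stage-entry : ∀ m t → stage (suc m) t ≡ true → stage m t ≡ true ⊎ (priority t ≡ m × Splits (stage m) t)
  stage-entry m t p with ∨-true p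
  ... | inj₁ old = inj₁ old
  ... | inj₂ new with ∧-true new
  ...   | at-m , splits = inj₂ (does-true (priority t ℕ.≟ m) at-m , does-true (splits? (stage m) t) splits)

  stage-mono : ∀ m m' → m ≤ m' → ∀ t → stage m t ≡ true → stage m' t ≡ true
  stage-mono zero m' _ t ()
  stage-mono (suc m) (suc m') le t p with m≤n⇒m<n∨m≡n le
  ... | inj₂ refl = p
  ... | inj₁ (s≤s le') = ∨-introˡ (stage-mono (suc m) m' le' t p)

  stage-priority : ∀ m t → stage m t ≡ true → priority t < m
  stage-priority (suc m) t p with stage-entry m t p
  ... | inj₁ old = m<n⇒m<1+n (stage-priority m t old)
  ... | inj₂ (refl , _) = n<1+n (priority t)

  stage-splits : ∀ m t → stage m t ≡ true → Splits (stage (priority t)) t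
  stage-splits (suc m) t p with stage-entry m t p
  ... | inj₁ old = stage-splits m t old
  ... | inj₂ (refl , splits) = splits

  stage-admits : ∀ t → Splits (stage (priority t)) t → stage (suc (priority t)) t ≡ true
  stage-admits t splits =
    ∨-introʳ (∧-intro (dec-true (priority t ℕ.≟ priority t) refl) (dec-true (splits? (stage (priority t)) t) splits))

  selected-intro : ∀ {t} → Splits (stage (priority t)) t → selected t ≡ true
  selected-intro {t} splits = stage-mono (suc (priority t)) M (priority<M t) t (stage-admits t splits)

  selected-splits : ∀ {t} → selected t ≡ true → Splits (stage (priority t)) t
  selected-splits {t} = stage-splits M t

  selected-test : ∀ {t} → selected t ≡ true → inP t ≡ false
  selected-test p = proj₁ (selected-splits p)

  selected-failed : ∀ {t} → selected t ≡ true → ∃ λ x → inP x ≡ true × test x t ≡ false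
  selected-failed {t} p with selected-splits p
  ... | _ , u , v , u∈P , v∈P , _ , differ with bool-cases (test u t) | bool-cases (test v t)
  ... | inj₂ fails | _ = u , u∈P , fails
  ... | inj₁ _ | inj₂ fails = v , v∈P , fails
  ... | inj₁ pu | inj₁ pv = ⊥-elim (differ (trans pu (≡-sym pv)))

  -- Completeness: points distinguished by some test are distinguished by a
  -- selected one (otherwise that test would have been selected).
  selected-separates : ∀ {u v s} → inP u ≡ true → inP v ≡ true → inP s ≡ false → test u s ≢ test v s →
                       ∃ λ t → selected t ≡ true × test u t ≢ test v t
  selected-separates {u} {v} {s} u∈P v∈P s∉P differ with sameTrace? selected u v
  ... | yes same = ⊥-elim (differ (same s (selected-intro (s∉P , u , v , u∈P , v∈P , same-before , differ))))
    where
      same-before : SameTrace (stage (priority s)) u v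
      same-before = sameTrace-restrict (stage-mono (priority s) M (<⇒≤ (priority<M s))) same
  ... | no ¬same with ¬∀⟶∃¬ n _ (λ t → (selected t Bool.≟ true) →-dec (test u t Bool.≟ test v t)) ¬same
  ...   | t , ¬agree with bool-cases (selected t)
  ...     | inj₁ sel = t , sel , λ e → ¬agree (λ _ → e)
  ...     | inj₂ unsel = ⊥-elim (¬agree (λ sel → ⊥-elim (true≢false (trans (≡-sym sel) unsel))))

  LeastInClass : (Fin n → Bool) → Fin n → Set
  LeastInClass X z = inP z ≡ true × (∀ m → inP m ≡ true → toℕ m < toℕ z → ¬ SameTrace X m z)

  leastInClass-refine : ∀ {X Y z} → (∀ t → X t ≡ true → Y t ≡ true) → LeastInClass X z → LeastInClass Y z
  leastInClass-refine X⊆Y (z∈P , least-z) = z∈P , λ m m∈P m<z same → least-z m m∈P m<z (sameTrace-restrict X⊆Y same)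

  least-in-class : ∀ X u → inP u ≡ true → Σ (Fin n) λ z → LeastInClass X z × SameTrace X z u
  least-in-class X u u∈P with least (λ z → inP z ≡ true × SameTrace X z u)
                                   (λ z → (inP z Bool.≟ true) ×-dec sameTrace? X z u) u (u∈P , λ _ _ → refl)
  ... | z , (z∈P , zu) , minimal =
    z , (z∈P , λ m m∈P m<z mz → <⇒≱ m<z (minimal m (m∈P , sameTrace-trans mz zu))) , zu

  NewLeast : Fin n → Fin n → Set
  NewLeast t z = LeastInClass (stage (suc (priority t))) z ×
                 ∃ λ m → inP m ≡ true × toℕ m < toℕ z × SameTrace (stage (priority t)) m z

  newLeast? : ∀ t z → Dec (NewLeast t z)
  newLeast? t z = ((inP z Bool.≟ true) ×-dec all? (λ m → (inP m Bool.≟ true) →-dec ((toℕ m <? toℕ z) →-dec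
                    ¬? (sameTrace? _ m z))))
                  ×-dec any? (λ m → (inP m Bool.≟ true) ×-dec (toℕ m <? toℕ z) ×-dec sameTrace? _ m z)

  newLeast-from : ∀ {t a b} → Splits (stage (priority t)) t → inP b ≡ true →
                  LeastInClass (stage (priority t)) a → SameTrace (stage (priority t)) a b →
                  test a t ≢ test b t → ∃ (NewLeast t)
  newLeast-from {t} {a} {b} splits b∈P least-a ab differ with least-in-class (stage (suc (priority t))) b b∈P
  ... | z , least-z , zb = z , least-z , a , proj₁ least-a , a<z , az
    where
      zb-before : SameTrace (stage (priority t)) z b
      zb-before = sameTrace-restrict (λ _ → ∨-introˡ) zb
      az : SameTrace (stage (priority t)) a z
      az = sameTrace-trans ab (sameTrace-sym zb-before)
      a<z : toℕ a < toℕ z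
      a<z with <-cmp (toℕ a) (toℕ z)
      ... | tri< lt _ _ = lt
      ... | tri≈ _ eq _ = ⊥-elim (differ (subst (λ x → test x t ≡ test b t) (≡-sym (toℕ-injective eq))
                                                   (zb t (stage-admits t splits))))
      ... | tri> _ _ gt = ⊥-elim (proj₂ least-a z (proj₁ least-z) gt (sameTrace-sym az))

  newLeast-exists : ∀ {t} → selected t ≡ true → ∃ (NewLeast t)
  newLeast-exists {t} sel with selected-splits sel
  ... | splits@(_ , u , v , u∈P , v∈P , uv , differ) with least-in-class (stage (priority t)) u u∈P
  ...   | a , least-a , au with test a t Bool.≟ test u t
  ...     | no a≠u = newLeast-from splits u∈P least-a au a≠u
  ...     | yes a=u = newLeast-from splits v∈P least-a (sameTrace-trans au uv) (λ e → differ (trans (≡-sym a=u) e))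

  -- The witness of a selected test: a new class minimum it creates.  (Opaque:
  -- only its specification matters, and unfolding the search is costly.)
  opaque
    witness : Fin n → Fin n
    witness t = choose (any? (newLeast? t)) t

    witness-spec : ∀ {t} → selected t ≡ true → NewLeast t (witness t)
    witness-spec {t} sel = choose-spec (any? (newLeast? t)) t (newLeast-exists sel)

  witness-inP : ∀ {t} → selected t ≡ true → inP (witness t) ≡ true
  witness-inP sel = proj₁ (proj₁ (witness-spec sel))

  witness-not-least : ∀ {t} → selected t ≡ true → ∃ λ m → inP m ≡ true × toℕ m < toℕ (witness t)
  witness-not-least sel with witness-spec sel
  ... | _ , m , m∈P , m<z , _ = m , m∈P , m<z

  -- A witness created earlier stays a class minimum, so it is not created again.
  witness-created-once : ∀ {t₁ t₂} → selected t₁ ≡ true → selected t₂ ≡ true →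
                         priority t₁ < priority t₂ → witness t₁ ≢ witness t₂
  witness-created-once {t₁} {t₂} sel₁ sel₂ lt e with witness-spec sel₂
  ... | _ , m , m∈P , m<z , mz = proj₂ still-least m m∈P (subst (λ z → toℕ m < toℕ z) (≡-sym e) m<z)
                                                     (subst (SameTrace (stage (priority t₂)) m) (≡-sym e) mz)
    where
      still-least : LeastInClass (stage (priority t₂)) (witness t₁)
      still-least = leastInClass-refine (stage-mono (suc (priority t₁)) (priority t₂) lt) (proj₁ (witness-spec sel₁))

  witness-injective : ∀ {t₁ t₂} → selected t₁ ≡ true → selected t₂ ≡ true →
                      witness t₁ ≡ witness t₂ → t₁ ≡ t₂
  witness-injective {t₁} {t₂} sel₁ sel₂ e with <-cmp (priority t₁) (priority t₂)
  ... | tri< lt _ _ = ⊥-elim (witness-created-once sel₁ sel₂ lt e)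
  ... | tri≈ _ eq _ = priority-injective eq
  ... | tri> _ _ gt = ⊥-elim (witness-created-once sel₂ sel₁ gt (≡-sym e))

module ColourCount where

  below-2w∸1 : ∀ c w → suc (suc c) ≤ 2 * w → c < 2 * w ∸ 1
  below-2w∸1 c w le = m+n≤o⇒m≤o∸n (suc c) (subst (_≤ 2 * w) (+-comm 1 (suc c)) le)

  private
    double : ∀ m → 2 * m ≡ m + m
    double m = cong (m +_) (+-identityʳ m)

  -- The largest colour of case A, (k + 1) + pred k with k < w, fits.
  caseA-fits : ∀ k w → k < w → 2 ≤ w → suc k + pred k < 2 * w ∸ 1
  caseA-fits zero w _ 2≤w = below-2w∸1 1 w (≤-trans (n≤1+n 3) (*-monoʳ-≤ 2 2≤w))
  caseA-fits (suc j) w k<w _ = below-2w∸1 (suc (suc j) + j) w (subst (_≤ 2 * w) 2[j+2]≡ (*-monoʳ-≤ 2 k<w))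
    where
      2[j+2]≡ : 2 * suc (suc j) ≡ suc (suc (suc (suc j) + j))
      2[j+2]≡ = begin
        2 * suc (suc j)                 ≡⟨ double (suc (suc j)) ⟩
        suc (suc j) + suc (suc j)       ≡⟨ cong (suc ∘ suc) (+-suc j (suc j)) ⟩
        suc (suc (suc (j + suc j)))     ≡⟨ cong (suc ∘ suc ∘ suc) (+-suc j j) ⟩
        suc (suc (suc (suc j) + j))     ∎
        where open ≡-Reasoning

  -- The largest colour of case B, pred w + pred w, fits.
  caseB-fits : ∀ w → 1 ≤ w → pred w + pred w < 2 * w ∸ 1
  caseB-fits (suc v) _ = below-2w∸1 (v + v) (suc v) (≤-reflexive (≡-sym 2[v+1]≡))
    where
      2[v+1]≡ : 2 * suc v ≡ suc (suc (v + v))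
      2[v+1]≡ = trans (double (suc v)) (cong suc (+-suc v v))

open ColourCount

-- Clique vertices are ranked 0, …, k−1 by index, and the greedy separating set
-- is run on the clique vertices with the S-vertices as tests (t is passed by
-- its neighbours), examining first, in order of index, the near-full vertices:
-- those adjacent to all of K but one vertex.
module SplitGraph {n : ℕ} (G : Graph n) (K : Subset n) (K-clique : IsClique G K)
                  (S-independent : IsIndependent G (λ v → v ∉ K)) where

  inK : Fin n → Bool
  inK = lookup K

  k : ℕ
  k = count inK

  clique-adj : ∀ {u v} → inK u ≡ true → inK v ≡ true → u ≢ v → Adj G u v
  clique-adj {u} {v} u∈K v∈K = K-clique u v (lookup⇒[]= u K u∈K) (lookup⇒[]= v K v∈K)

  independent : ∀ {u v} → inK u ≡ false → inK v ≡ false → ¬ Adj G u v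
  independent u∉K v∉K = S-independent _ _ (∉K u∉K) (∉K v∉K)
    where
      ∉K : ∀ {u} → inK u ≡ false → u ∉ K
      ∉K e m = true≢false (trans (≡-sym ([]=⇒lookup m)) e)

  S-nbr-in-K : ∀ {s w} → inK s ≡ false → Adj G s w → inK w ≡ true
  S-nbr-in-K {s} {w} s∉K a with bool-cases (inK w)
  ... | inj₁ w∈K = w∈K
  ... | inj₂ w∉K = ⊥-elim (independent s∉K w∉K a)

  K⊆N[u] : ∀ {u x} → inK u ≡ true → inK x ≡ true → InClosedNbhd G u x
  K⊆N[u] {u} {x} u∈K x∈K with x Fin.≟ u
  ... | yes x≡u = inj₁ x≡u
  ... | no x≢u = inj₂ (clique-adj u∈K x∈K (λ e → x≢u (≡-sym e)))

  sees : Fin n → Fin n → Bool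
  sees u t = does (adj? G u t)

  sees-adj : ∀ {u t} → Adj G u t → sees u t ≡ true
  sees-adj {u} {t} = dec-true (adj? G u t)

  sees→adj : ∀ {u t} → sees u t ≡ true → Adj G u t
  sees→adj {u} {t} = does-true (adj? G u t)

  sees→nonadj : ∀ {u t} → sees u t ≡ false → ¬ Adj G u t
  sees→nonadj {u} {t} = does-false (adj? G u t)

  rank : Fin n → ℕ
  rank v = count (λ u → inK u ∧ does (toℕ u <? toℕ v))

  private
    not-below-itself : ∀ v → inK v ∧ does (toℕ v <? toℕ v) ≡ false
    not-below-itself v = trans (cong (inK v ∧_) (dec-false (toℕ v <? toℕ v) (<-irrefl refl))) (Bool.∧-zeroʳ (inK v))

  rank-mono : ∀ {u v} → inK u ≡ true → toℕ u < toℕ v → rank u < rank v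
  rank-mono {u} {v} u∈K u<v = count-strict _ _ below-u⇒below-v u (∧-intro u∈K (dec-true (toℕ u <? toℕ v) u<v))
                                           (not-below-itself u)
    where
      below-u⇒below-v : ∀ i → inK i ∧ does (toℕ i <? toℕ u) ≡ true → inK i ∧ does (toℕ i <? toℕ v) ≡ true
      below-u⇒below-v i p with ∧-true p
      ... | i∈K , i<u = ∧-intro i∈K (dec-true (toℕ i <? toℕ v) (<-trans (does-true (toℕ i <? toℕ u) i<u) u<v))

  rank<k : ∀ {v} → inK v ≡ true → rank v < k
  rank<k {v} v∈K = count-strict _ inK (λ i p → proj₁ (∧-true p)) v v∈K (not-below-itself v)

  rank-injective : ∀ {u v} → inK u ≡ true → inK v ≡ true → rank u ≡ rank v → u ≡ v
  rank-injective {u} {v} u∈K v∈K e with <-cmp (toℕ u) (toℕ v)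
  ... | tri< lt _ _ = ⊥-elim (<-irrefl e (rank-mono u∈K lt))
  ... | tri≈ _ eq _ = toℕ-injective eq
  ... | tri> _ _ gt = ⊥-elim (<-irrefl (≡-sym e) (rank-mono v∈K gt))

  third-clique-vertex : 3 ≤ k → ∀ a b → ∃ λ z → inK z ≡ true × z ≢ a × z ≢ b
  third-clique-vertex k≥3 a b with any? (λ z → (inK z Bool.≟ true) ×-dec ¬? (z Fin.≟ a) ×-dec ¬? (z Fin.≟ b))
  ... | yes found = found
  ... | no ¬found = ⊥-elim (<⇒≱ k≥3 (≤-trans (count-union inK is-a is-b K⊆a∪b)
                      (+-mono-≤ (count-single is-a a (λ i → does-true (i Fin.≟ a)))
                                (count-single is-b b (λ i → does-true (i Fin.≟ b))))))
    where
      is-a is-b : Fin n → Bool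
      is-a i = does (i Fin.≟ a)
      is-b i = does (i Fin.≟ b)
      K⊆a∪b : ∀ i → inK i ≡ true → is-a i ≡ true ⊎ is-b i ≡ true
      K⊆a∪b i i∈K with i Fin.≟ a | i Fin.≟ b
      ... | yes _ | _ = inj₁ refl
      ... | no _ | yes _ = inj₂ refl
      ... | no i≢a | no i≢b = ⊥-elim (¬found (i , i∈K , i≢a , i≢b))

  MissesOnly : Fin n → Fin n → Set
  MissesOnly s x = inK x ≡ true × ¬ Adj G s x × (∀ y → inK y ≡ true → y ≢ x → Adj G s y)

  NearFull : Fin n → Set
  NearFull s = inK s ≡ false × ∃ (MissesOnly s)

  nearFull? : ∀ s → Dec (NearFull s)
  nearFull? s = (inK s Bool.≟ false) ×-dec any? (λ x → (inK x Bool.≟ true) ×-dec ¬? (adj? G s x) ×-dec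
    all? (λ y → (inK y Bool.≟ true) →-dec (¬? (y Fin.≟ x) →-dec adj? G s y)))

  missesOnly-unique : ∀ {s x a} → MissesOnly s x → inK a ≡ true → ¬ Adj G s a → a ≡ x
  missesOnly-unique {s} {x} {a} (_ , _ , sees-others) a∈K ¬sa with a Fin.≟ x
  ... | yes a≡x = a≡x
  ... | no a≢x = ⊥-elim (¬sa (sees-others a a∈K a≢x))

  priority : Fin n → ℕ
  priority s = if does (nearFull? s) then toℕ s else n + toℕ s

  private
    priority-nearFull : ∀ {s} → NearFull s → priority s ≡ toℕ s
    priority-nearFull {s} nf rewrite dec-true (nearFull? s) nf = refl

    priority-other : ∀ {s} → ¬ NearFull s → priority s ≡ n + toℕ s
    priority-other {s} ¬nf rewrite dec-false (nearFull? s) ¬nf = refl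

  priority-injective : ∀ {s t} → priority s ≡ priority t → s ≡ t
  priority-injective {s} {t} e with nearFull? s | nearFull? t
  ... | yes ps | yes pt = toℕ-injective (trans (≡-sym (priority-nearFull ps)) (trans e (priority-nearFull pt)))
  ... | no ps | no pt = toℕ-injective (+-cancelˡ-≡ n _ _ (trans (≡-sym (priority-other ps)) (trans e (priority-other pt))))
  ... | yes ps | no pt = ⊥-elim (<⇒≱ (toℕ<n s) (≤-trans (m≤m+n n (toℕ t))
                           (≤-reflexive (trans (≡-sym (priority-other pt)) (trans (≡-sym e) (priority-nearFull ps))))))
  ... | no ps | yes pt = ⊥-elim (<⇒≱ (toℕ<n t) (≤-trans (m≤m+n n (toℕ s))
                           (≤-reflexive (trans (≡-sym (priority-other ps)) (trans e (priority-nearFull pt))))))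

  priority<2n : ∀ s → priority s < n + n
  priority<2n s with nearFull? s
  ... | yes nf rewrite priority-nearFull nf = <-≤-trans (toℕ<n s) (m≤m+n n n)
  ... | no ¬nf rewrite priority-other ¬nf = +-monoʳ-< n (toℕ<n s)

  before-nearFull : ∀ {s t} → NearFull s → priority t < priority s → NearFull t × toℕ t < toℕ s
  before-nearFull {s} {t} nf-s lt with nearFull? t
  ... | yes nf-t = nf-t , subst₂ _<_ (priority-nearFull nf-t) (priority-nearFull nf-s) lt
  ... | no ¬nf-t = ⊥-elim (<⇒≱ (<-trans (subst (priority t <_) (priority-nearFull nf-s) lt) (toℕ<n s))
                                   (≤-trans (m≤m+n n (toℕ t)) (≤-reflexive (≡-sym (priority-other ¬nf-t)))))

  open GreedySeparator inK sees priority (n + n) priority-injective priority<2n public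

  selected-misses : ∀ {t} → selected t ≡ true → ∃ λ x → inK x ≡ true × ¬ Adj G t x
  selected-misses sel with selected-failed sel
  ... | x , x∈K , x-fails = x , x∈K , λ a → sees→nonadj x-fails (sym G a)

  witness-rank-positive : ∀ {t} → selected t ≡ true → 0 < rank (witness t)
  witness-rank-positive sel with witness-not-least sel
  ... | m , m∈K , m<z = ≤-<-trans z≤n (rank-mono m∈K m<z)

  -- A near-full vertex s missing x is selected as soon as, for some clique
  -- vertex a ≠ x, all near-full vertices of smaller index miss a: those then
  -- all see x and a third clique vertex z, which s tells apart.
  nearFull-selected : 3 ≤ k → ∀ {s x a} → inK s ≡ false → MissesOnly s x → inK a ≡ true → x ≢ a →
                      (∀ t → NearFull t → toℕ t < toℕ s → ¬ Adj G t a) → selected s ≡ true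
  nearFull-selected k≥3 {s} {x} {a} s∉K s-misses-x a∈K x≢a earlier-miss-a with third-clique-vertex k≥3 x a
  ... | z , z∈K , z≢x , z≢a = selected-intro (s∉K , x , z , proj₁ s-misses-x , z∈K , same-before , differ)
    where
      same-before : SameTrace (stage (priority s)) x z
      same-before t t∈stage with before-nearFull (s∉K , x , s-misses-x) (stage-priority (priority s) t t∈stage)
      ... | nf-t@(_ , y , t-misses-y) , t<s =
        trans (sees-adj (sym G (t-sees x (proj₁ s-misses-x) x≢a))) (≡-sym (sees-adj (sym G (t-sees z z∈K z≢a))))
        where
          a≡y : a ≡ y
          a≡y = missesOnly-unique t-misses-y a∈K (earlier-miss-a t nf-t t<s)
          t-sees : ∀ v → inK v ≡ true → v ≢ a → Adj G t v
          t-sees v v∈K v≢a = proj₂ (proj₂ t-misses-y) v v∈K (λ v≡y → v≢a (trans v≡y (≡-sym a≡y)))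
      differ : sees x s ≢ sees z s
      differ e = proj₁ (proj₂ s-misses-x) (sym G (sees→adj (trans e (sees-adj (sym G s~z)))))
        where
          s~z : Adj G s z
          s~z = proj₂ (proj₂ s-misses-x) z z∈K z≢x

  -- If k ≥ 3, a clique neighbour u of a near-full vertex has a selected
  -- neighbour: the first near-full vertex s₁ is selected and sees all of K but
  -- its missed vertex x₁; if u = x₁, so is the first near-full vertex seeing x₁.
  nearFull-nbr-sees-selected : 3 ≤ k → ∀ {s u} → NearFull s → inK u ≡ true → Adj G s u →
                               ∃ λ t → selected t ≡ true × Adj G u t
  nearFull-nbr-sees-selected k≥3 {s} {u} nf-s u∈K s~u with least NearFull nearFull? s nf-s
  ... | s₁ , (s₁∉K , x₁ , s₁-misses-x₁) , first₁ with third-clique-vertex k≥3 x₁ x₁ | u Fin.≟ x₁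
  ...   | a , a∈K , a≢x₁ , _ | no u≢x₁ = s₁ , sel₁ , sym G (proj₂ (proj₂ s₁-misses-x₁) u u∈K u≢x₁)
    where
      sel₁ : selected s₁ ≡ true
      sel₁ = nearFull-selected k≥3 s₁∉K s₁-misses-x₁ a∈K (λ e → a≢x₁ (≡-sym e))
               (λ t nf-t t<s₁ → ⊥-elim (<⇒≱ t<s₁ (first₁ t nf-t)))
  ...   | _ | yes refl
    with least (λ s' → NearFull s' × Adj G s' u) (λ s' → nearFull? s' ×-dec adj? G s' u) s (nf-s , s~u)
  ...     | s₂ , ((s₂∉K , x₂ , s₂-misses-x₂) , s₂~u) , first₂ = s₂ , sel₂ , sym G s₂~u
    where
      sel₂ : selected s₂ ≡ true
      sel₂ = nearFull-selected k≥3 s₂∉K s₂-misses-x₂ u∈K (λ { refl → proj₁ (proj₂ s₂-misses-x₂) s₂~u })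
               (λ t nf-t t<s₂ t~u → <⇒≱ t<s₂ (first₂ t (nf-t , t~u)))

  same-S-nbrs⇒N⊆N : ∀ {u v w} → inK u ≡ true → inK v ≡ true → (∀ s → inK s ≡ false → sees u s ≡ sees v s) →
                    InClosedNbhd G u w → InClosedNbhd G v w
  same-S-nbrs⇒N⊆N {u} {v} {w} u∈K v∈K same w∈N[u] with bool-cases (inK w)
  ... | inj₁ w∈K = K⊆N[u] v∈K w∈K
  ... | inj₂ w∉K with w∈N[u]
  ...   | inj₁ refl = ⊥-elim (true≢false (trans (≡-sym u∈K) w∉K))
  ...   | inj₂ u~w = inj₂ (sees→adj (trans (≡-sym (same w w∉K)) (sees-adj u~w)))

  -- When k ≤ base + 1 and other s ≤ base,
  -- colours of selected vertices are private: used by exactly one vertex.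
  module Scheme (base : ℕ) (other : Fin n → ℕ) (k≤1+base : k ≤ suc base)
                (other≤base : ∀ s → inK s ≡ false → selected s ≡ false → other s ≤ base) where

    col : Fin n → ℕ
    col v = if inK v then rank v else (if selected v then base + rank (witness v) else other v)

    col-K : ∀ {v} → inK v ≡ true → col v ≡ rank v
    col-K e rewrite e = refl

    col-selected : ∀ {v} → selected v ≡ true → col v ≡ base + rank (witness v)
    col-selected {v} e rewrite selected-test e | e = refl

    col-other : ∀ {v} → inK v ≡ false → selected v ≡ false → col v ≡ other v
    col-other e e' rewrite e | e' = refl

    open LidCriterion G col public

    col-bound : ∀ v → col v ≤ base + pred k
    col-bound v with bool-cases (inK v)
    ... | inj₁ v∈K rewrite col-K v∈K = ≤-trans (<⇒≤pred (<-≤-trans (rank<k v∈K) k≤1+base)) (m≤m+n base (pred k))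
    ... | inj₂ v∉K with bool-cases (selected v)
    ...   | inj₁ sel rewrite col-selected sel = +-monoʳ-≤ base (<⇒≤pred (rank<k (witness-inP sel)))
    ...   | inj₂ unsel rewrite col-other v∉K unsel = ≤-trans (other≤base v v∉K unsel) (m≤m+n base (pred k))

    base<selected : ∀ {t} → selected t ≡ true → base < col t
    base<selected {t} sel rewrite col-selected sel =
      subst (_≤ base + rank (witness t)) (+-comm base 1) (+-monoʳ-≤ base (witness-rank-positive sel))

    K<selected : ∀ {x t} → inK x ≡ true → selected t ≡ true → col x < col t
    K<selected {x} x∈K sel rewrite col-K x∈K = <-≤-trans (rank<k x∈K) (≤-trans k≤1+base (base<selected sel))

    selected-private : ∀ {t w} → selected t ≡ true → col w ≡ col t → w ≡ t
    selected-private {t} {w} sel e with bool-cases (inK w)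
    ... | inj₁ w∈K = ⊥-elim (<-irrefl e (K<selected w∈K sel))
    ... | inj₂ w∉K with bool-cases (selected w)
    ...   | inj₁ sel-w = witness-injective sel-w sel (rank-injective (witness-inP sel-w) (witness-inP sel)
                           (+-cancelˡ-≡ base _ _ (trans (≡-sym (col-selected sel-w)) (trans e (col-selected sel)))))
    ...   | inj₂ unsel-w = ⊥-elim (<-irrefl e (≤-<-trans (≤-reflexive (col-other w∉K unsel-w))
                             (≤-<-trans (other≤base w w∉K unsel-w) (base<selected sel))))

    selected-private-colour : ∀ {u v t} → selected t ≡ true → Adj G u t → ¬ InClosedNbhd G v t → PrivateColour u v
    selected-private-colour {v = v} sel u~t t∉N[v] =
      _ , inj₂ u~t , λ w w∈N[v] e → t∉N[v] (subst (InClosedNbhd G v) (selected-private sel e) w∈N[v])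

    selected∉N : ∀ {x t} → inK x ≡ true → selected t ≡ true → ¬ Adj G x t → ¬ InClosedNbhd G x t
    selected∉N x∈K sel _ (inj₁ refl) = true≢false (trans (≡-sym x∈K) (selected-test sel))
    selected∉N _ _ ¬x~t (inj₂ x~t) = ¬x~t x~t

    proper-KK : ∀ {u v} → inK u ≡ true → inK v ≡ true → Adj G u v → col u ≢ col v
    proper-KK {u} {v} u∈K v∈K u~v e =
      irrefl G (subst (Adj G u) (≡-sym (rank-injective u∈K v∈K (trans (≡-sym (col-K u∈K)) (trans e (col-K v∈K))))) u~v)

    -- Two clique vertices with different S-neighbourhoods are told apart by a
    -- selected vertex, whose private colour separates them.
    separated-KK : ∀ {u v} → inK u ≡ true → inK v ≡ true → Separated u v
    separated-KK {u} {v} u∈K v∈K with all? (λ s → (inK s Bool.≟ false) →-dec (sees u s Bool.≟ sees v s))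
    ... | yes same = inj₂ (inj₂ λ w → mk⇔ (same-S-nbrs⇒N⊆N u∈K v∈K same)
                                         (same-S-nbrs⇒N⊆N v∈K u∈K (λ s s∉K → ≡-sym (same s s∉K))))
    ... | no ¬same with ¬∀⟶∃¬ n _ (λ s → (inK s Bool.≟ false) →-dec (sees u s Bool.≟ sees v s)) ¬same
    ...   | s , ¬agree with bool-cases (inK s)
    ...     | inj₁ s∈K = ⊥-elim (¬agree (λ s∉K → ⊥-elim (true≢false (trans (≡-sym s∈K) s∉K))))
    ...     | inj₂ s∉K with selected-separates u∈K v∈K s∉K (λ e → ¬agree (λ _ → e))
    ...       | t , sel , differ with bool-cases (sees u t) | bool-cases (sees v t)
    ...         | inj₁ ut | inj₂ vt =
                    inj₁ (selected-private-colour sel (sees→adj ut) (selected∉N v∈K sel (sees→nonadj vt)))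
    ...         | inj₂ ut | inj₁ vt =
                    inj₂ (inj₁ (selected-private-colour sel (sees→adj vt) (selected∉N u∈K sel (sees→nonadj ut))))
    ...         | inj₁ ut | inj₁ vt = ⊥-elim (differ (trans ut (≡-sym vt)))
    ...         | inj₂ ut | inj₂ vt = ⊥-elim (differ (trans ut (≡-sym vt)))

    -- An edge us with u ∈ K, s ∈ S is separated when s misses a clique vertex x
    -- whose colour s does not carry: x ∈ N[u], and rank is injective on K.
    separated-by-missed : ∀ {u s x} → inK u ≡ true → Adj G u s → inK s ≡ false → inK x ≡ true →
                          ¬ Adj G s x → col s ≢ rank x → Separated u s
    separated-by-missed {u} {s} {x} u∈K u~s s∉K x∈K ¬s~x col-s≢ = inj₁ (x , K⊆N[u] u∈K x∈K , unseen)
      where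
        unseen : ∀ w → InClosedNbhd G s w → col w ≢ col x
        unseen w (inj₁ refl) e = col-s≢ (trans e (col-K x∈K))
        unseen w (inj₂ s~w) e with rank-injective (S-nbr-in-K s∉K s~w) x∈K
                                     (trans (≡-sym (col-K (S-nbr-in-K s∉K s~w))) (trans e (col-K x∈K)))
        ... | refl = ¬s~x s~w

    separated-selected : ∀ {u s} → inK u ≡ true → Adj G u s → selected s ≡ true → Separated u s
    separated-selected {u} {s} u∈K u~s sel with selected-misses sel
    ... | x , x∈K , ¬s~x = separated-by-missed u∈K u~s (selected-test sel) x∈K ¬s~x
                             (λ e → <-irrefl (≡-sym e) (subst (_< col s) (col-K x∈K) (K<selected x∈K sel)))

    lid-from-KS : ∀ {N} → (∀ v → col v < N) →
                  (∀ {x s} → inK x ≡ true → inK s ≡ false → Adj G x s → col x ≢ col s) →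
                  (∀ {u s} → inK u ≡ true → Adj G u s → inK s ≡ false → Separated u s) →
                  LidChromaticAtMost G N
    lid-from-KS bounded proper-KS separated-KS = lid-colouring bounded proper separated
      where
        proper : ∀ u v → Adj G u v → col u ≢ col v
        proper u v u~v with bool-cases (inK u) | bool-cases (inK v)
        ... | inj₁ u∈K | inj₁ v∈K = proper-KK u∈K v∈K u~v
        ... | inj₁ u∈K | inj₂ v∉K = proper-KS u∈K v∉K u~v
        ... | inj₂ u∉K | inj₁ v∈K = λ e → proper-KS v∈K u∉K (sym G u~v) (≡-sym e)
        ... | inj₂ u∉K | inj₂ v∉K = ⊥-elim (independent u∉K v∉K u~v)
        separated : ∀ u v → Adj G u v → Separated u v
        separated u v u~v with bool-cases (inK u) | bool-cases (inK v)
        ... | inj₁ u∈K | inj₁ v∈K = separated-KK u∈K v∈K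
        ... | inj₁ u∈K | inj₂ v∉K = separated-KS u∈K u~v v∉K
        ... | inj₂ u∉K | inj₁ v∈K = separated-sym (separated-KS v∈K (sym G u~v) u∉K)
        ... | inj₂ u∉K | inj₂ v∉K = ⊥-elim (independent u∉K v∉K u~v)

  Full : Fin n → Set
  Full s = inK s ≡ false × (∀ x → inK x ≡ true → Adj G s x)

  full? : ∀ s → Dec (Full s)
  full? s = (inK s Bool.≟ false) ×-dec all? (λ x → (inK x Bool.≟ true) →-dec adj? G s x)

  misses-some : ∀ {s} → inK s ≡ false → ¬ Full s → ∃ λ x → inK x ≡ true × ¬ Adj G s x
  misses-some {s} s∉K ¬full
    with ¬∀⟶∃¬ n _ (λ x → (inK x Bool.≟ true) →-dec adj? G s x) (λ sees-K → ¬full (s∉K , sees-K))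
  ... | x , ¬sees with bool-cases (inK x)
  ...   | inj₁ x∈K = x , x∈K , λ s~x → ¬sees (λ _ → s~x)
  ...   | inj₂ x∉K = ⊥-elim (¬sees (λ x∈K → ⊥-elim (true≢false (trans (≡-sym x∈K) x∉K))))

  -- Case k < ω(G), ω(G) ≥ 2: colours 0, …, k − 1 on K, colour k on the full
  -- vertex of least index, k + 1 on the other unselected vertices of S, and
  -- k + 1 + rank (witness t) ≤ 2k on the selected ones.
  module CaseA (w : ℕ) (k<w : k < w) (2≤w : 2 ≤ w) where

    isFirstFull : Fin n → Bool
    isFirstFull s = does (full? s ×-dec all? (λ t → full? t →-dec (toℕ s ≤? toℕ t)))

    firstFull-full : ∀ {s} → isFirstFull s ≡ true → Full s
    firstFull-full {s} e = proj₁ (does-true (full? s ×-dec all? (λ t → full? t →-dec (toℕ s ≤? toℕ t))) e)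

    firstFull-unique : ∀ {s s'} → isFirstFull s ≡ true → isFirstFull s' ≡ true → s ≡ s'
    firstFull-unique {s} {s'} e e' with does-true (full? s ×-dec all? (λ t → full? t →-dec (toℕ s ≤? toℕ t))) e
                                      | does-true (full? s' ×-dec all? (λ t → full? t →-dec (toℕ s' ≤? toℕ t))) e'
    ... | full-s , first-s | full-s' , first-s' = toℕ-injective (≤-antisym (first-s s' full-s') (first-s' s full-s))

    firstFull-exists : ∀ {s} → Full s → ∃ λ s₀ → isFirstFull s₀ ≡ true
    firstFull-exists {s} full-s with least Full full? s full-s
    ... | s₀ , full-s₀ , first = s₀ , dec-true (full? s₀ ×-dec all? (λ t → full? t →-dec (toℕ s₀ ≤? toℕ t)))
                                                (full-s₀ , first)

    other : Fin n → ℕ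
    other s = if isFirstFull s then k else suc k

    other≤1+k : ∀ s → other s ≤ suc k
    other≤1+k s with isFirstFull s
    ... | true = n≤1+n k
    ... | false = ≤-refl

    open Scheme (suc k) other (≤-trans (n≤1+n k) (n≤1+n (suc k))) (λ s _ _ → other≤1+k s)

    col-firstFull : ∀ {s} → isFirstFull s ≡ true → col s ≡ k
    col-firstFull {s} e = trans (col-other (proj₁ full-s) (unselected full-s)) (cong (if_then k else suc k) e)
      where
        full-s = firstFull-full e
        unselected : Full s → selected s ≡ false
        unselected (_ , sees-K) with bool-cases (selected s)
        ... | inj₂ unsel = unsel
        ... | inj₁ sel with selected-misses sel
        ...   | x , x∈K , ¬s~x = ⊥-elim (¬s~x (sees-K x x∈K))

    k≤col-S : ∀ {s} → inK s ≡ false → k ≤ col s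
    k≤col-S {s} s∉K with bool-cases (selected s)
    ... | inj₁ sel = ≤-trans (≤-trans (n≤1+n k) (n≤1+n (suc k))) (base<selected sel)
    ... | inj₂ unsel rewrite col-other s∉K unsel with isFirstFull s
    ...   | true = ≤-refl
    ...   | false = n≤1+n k

    k<col-S : ∀ {s} → inK s ≡ false → isFirstFull s ≡ false → k < col s
    k<col-S {s} s∉K not-first with bool-cases (selected s)
    ... | inj₁ sel = ≤-trans (n≤1+n (suc k)) (base<selected sel)
    ... | inj₂ unsel rewrite col-other s∉K unsel | not-first = ≤-refl

    K<S : ∀ {x s} → inK x ≡ true → inK s ≡ false → col x < col s
    K<S x∈K s∉K = <-≤-trans (subst (_< k) (≡-sym (col-K x∈K)) (rank<k x∈K)) (k≤col-S s∉K)

    S-nbr-col<k : ∀ {s w} → inK s ≡ false → Adj G s w → col w < k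
    S-nbr-col<k s∉K s~w = subst (_< k) (≡-sym (col-K (S-nbr-in-K s∉K s~w))) (rank<k (S-nbr-in-K s∉K s~w))

    -- A full vertex s other than the first one: the first full vertex s₀ is in
    -- N[u], and its colour k does not occur in N[s].
    separated-other-full : ∀ {u s} → inK u ≡ true → Full s → isFirstFull s ≡ false → Separated u s
    separated-other-full {u} {s} u∈K full-s@(s∉K , _) not-first with firstFull-exists full-s
    ... | s₀ , first-s₀ = inj₁ (s₀ , inj₂ (sym G (proj₂ (firstFull-full first-s₀) u u∈K)) , unseen)
      where
        unseen : ∀ w → InClosedNbhd G s w → col w ≢ col s₀
        unseen w (inj₁ refl) e = <-irrefl (≡-sym (trans e (col-firstFull first-s₀))) (k<col-S s∉K not-first)
        unseen w (inj₂ s~w) e = <-irrefl (trans e (col-firstFull first-s₀)) (S-nbr-col<k s∉K s~w)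

    -- The first full vertex s: either u has another neighbour y in S, whose
    -- colour exceeds all colours of N[s] = K ∪ {s}, or N[u] = K ∪ {s} = N[s].
    separated-first-full : ∀ {u s} → inK u ≡ true → Adj G u s → isFirstFull s ≡ true → Separated u s
    separated-first-full {u} {s} u∈K u~s first-s
      with any? (λ y → adj? G u y ×-dec (inK y Bool.≟ false) ×-dec (isFirstFull y Bool.≟ false))
    ... | yes (y , u~y , y∉K , not-first-y) = inj₁ (y , inj₂ u~y , unseen)
      where
        unseen : ∀ w → InClosedNbhd G s w → col w ≢ col y
        unseen w (inj₁ refl) e = <-irrefl (trans (≡-sym (col-firstFull first-s)) e) (k<col-S y∉K not-first-y)
        unseen w (inj₂ s~w) e =
          <-irrefl e (<-trans (S-nbr-col<k (proj₁ (firstFull-full first-s)) s~w) (k<col-S y∉K not-first-y))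
    ... | no ¬other = inj₂ (inj₂ λ w → mk⇔ N[u]⊆N[s] N[s]⊆N[u])
      where
        full-s = firstFull-full first-s
        N[u]⊆N[s] : ∀ {w} → InClosedNbhd G u w → InClosedNbhd G s w
        N[u]⊆N[s] {w} w∈N[u] with bool-cases (inK w)
        ... | inj₁ w∈K = inj₂ (proj₂ full-s w w∈K)
        ... | inj₂ w∉K with w∈N[u]
        ...   | inj₁ refl = ⊥-elim (true≢false (trans (≡-sym u∈K) w∉K))
        ...   | inj₂ u~w with bool-cases (isFirstFull w)
        ...     | inj₁ first-w = inj₁ (firstFull-unique first-w first-s)
        ...     | inj₂ not-first-w = ⊥-elim (¬other (w , u~w , w∉K , not-first-w))
        N[s]⊆N[u] : ∀ {w} → InClosedNbhd G s w → InClosedNbhd G u w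
        N[s]⊆N[u] (inj₁ refl) = inj₂ u~s
        N[s]⊆N[u] (inj₂ s~w) = K⊆N[u] u∈K (S-nbr-in-K (proj₁ full-s) s~w)

    separated-KS : ∀ {u s} → inK u ≡ true → Adj G u s → inK s ≡ false → Separated u s
    separated-KS {u} {s} u∈K u~s s∉K with bool-cases (selected s) | full? s
    ... | inj₁ sel | _ = separated-selected u∈K u~s sel
    ... | inj₂ _ | no ¬full with misses-some s∉K ¬full
    ...   | x , x∈K , ¬s~x = separated-by-missed u∈K u~s s∉K x∈K ¬s~x
                               (λ e → <-irrefl (≡-sym e) (subst (_< col s) (col-K x∈K) (K<S x∈K s∉K)))
    separated-KS u∈K u~s s∉K | inj₂ _ | yes full-s with bool-cases (isFirstFull _)
    ... | inj₁ first = separated-first-full u∈K u~s first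
    ... | inj₂ not-first = separated-other-full u∈K full-s not-first

    caseA-lid : LidChromaticAtMost G (2 * w ∸ 1)
    caseA-lid = lid-from-KS (λ v → ≤-<-trans (col-bound v) (caseA-fits k w k<w 2≤w))
                            (λ x∈K s∉K _ e → <-irrefl e (K<S x∈K s∉K)) separated-KS

  -- Case k = ω(G) ≥ 3: no vertex of S is full, colours 0, …, k − 1 on K, an
  -- unselected s ∈ S takes the colour of a clique vertex it misses, and a
  -- selected t takes k − 1 + rank (witness t) ≤ 2k − 2.
  module CaseB (w : ℕ) (ω≡w : IsCliqueNumber G w) (k≡w : k ≡ w) (3≤k : 3 ≤ k) where

    -- A full vertex would extend K to a clique larger than ω(G).
    no-full : ∀ {s} → ¬ Full s
    no-full (s∉K , sees-K) = <-irrefl k≡w (clique-extension<ω inK (λ u v u∈K v∈K → clique-adj u∈K v∈K) _ s∉K sees-K)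
      where open CliqueBound G w ω≡w

    opaque
      missed : Fin n → Fin n
      missed s = choose (any? (λ x → (inK x Bool.≟ true) ×-dec ¬? (adj? G s x))) s

      missed-spec : ∀ {s} → inK s ≡ false → inK (missed s) ≡ true × ¬ Adj G s (missed s)
      missed-spec {s} s∉K = choose-spec (any? (λ x → (inK x Bool.≟ true) ×-dec ¬? (adj? G s x))) s
                                        (misses-some s∉K no-full)

    other : Fin n → ℕ
    other s = rank (missed s)

    other<k : ∀ {s} → inK s ≡ false → other s < k
    other<k s∉K = rank<k (proj₁ (missed-spec s∉K))

    k≤1+pred-k : k ≤ suc (pred k)
    k≤1+pred-k with k
    ... | zero = z≤n
    ... | suc _ = ≤-refl

    open Scheme (pred k) other k≤1+pred-k (λ s s∉K _ → <⇒≤pred (other<k s∉K))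

    proper-KS : ∀ {x s} → inK x ≡ true → inK s ≡ false → Adj G x s → col x ≢ col s
    proper-KS {x} {s} x∈K s∉K x~s e with bool-cases (selected s)
    ... | inj₁ sel = <-irrefl e (K<selected x∈K sel)
    ... | inj₂ unsel with rank-injective x∈K (proj₁ (missed-spec s∉K))
                            (trans (≡-sym (col-K x∈K)) (trans e (col-other s∉K unsel)))
    ...   | refl = proj₂ (missed-spec s∉K) (sym G x~s)

    -- If s misses a second clique vertex y, the colour of y is absent from N[s];
    -- otherwise s is near-full and u has a selected neighbour.
    separated-KS : ∀ {u s} → inK u ≡ true → Adj G u s → inK s ≡ false → Separated u s
    separated-KS {u} {s} u∈K u~s s∉K with bool-cases (selected s)
    ... | inj₁ sel = separated-selected u∈K u~s sel
    ... | inj₂ unsel with any? (λ y → (inK y Bool.≟ true) ×-dec ¬? (adj? G s y) ×-dec ¬? (y Fin.≟ missed s))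
    ...   | yes (y , y∈K , ¬s~y , y≢missed) =
            separated-by-missed u∈K u~s s∉K y∈K ¬s~y
              (λ e → y≢missed (≡-sym (rank-injective (proj₁ (missed-spec s∉K)) y∈K
                                       (trans (≡-sym (col-other s∉K unsel)) e))))
    ...   | no ¬second with nearFull-nbr-sees-selected 3≤k near-full u∈K (sym G u~s)
      where
        near-full : NearFull s
        near-full = s∉K , missed s , proj₁ (missed-spec s∉K) , proj₂ (missed-spec s∉K) , sees-others
          where
            sees-others : ∀ y → inK y ≡ true → y ≢ missed s → Adj G s y
            sees-others y y∈K y≢missed with adj? G s y
            ... | yes s~y = s~y
            ... | no ¬s~y = ⊥-elim (¬second (y , y∈K , ¬s~y , y≢missed))
    ...     | t , sel-t , u~t = inj₁ (selected-private-colour sel-t u~t t∉N[s])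
      where
        t∉N[s] : ¬ InClosedNbhd G s t
        t∉N[s] (inj₁ refl) = true≢false (trans (≡-sym sel-t) unsel)
        t∉N[s] (inj₂ s~t) = independent s∉K (selected-test sel-t) s~t

    caseB-lid : LidChromaticAtMost G (2 * w ∸ 1)
    caseB-lid = lid-from-KS (λ v → ≤-<-trans (col-bound v) fits) proper-KS separated-KS
      where
        fits : pred k + pred k < 2 * w ∸ 1
        fits = subst (λ m → pred m + pred m < 2 * w ∸ 1) (≡-sym k≡w)
                     (caseB-fits w (≤-trans (s≤s z≤n) (subst (3 ≤_) k≡w 3≤k)))

split-lid : ∀ {n} (G : Graph n) (K : Subset n) → IsClique G K → IsIndependent G (λ v → v ∉ K) →
            ∀ w → IsCliqueNumber G w → 3 ≤ w → LidChromaticAtMost G (2 * w ∸ 1)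
split-lid G K K-clique S-independent w ω≡w 3≤w = by-size (m≤n⇒m<n∨m≡n k≤w)
  where
    open SplitGraph G K K-clique S-independent
    k≤w : k ≤ w
    k≤w = subst (_≤ w) (∣∣≡count K) (proj₂ ω≡w K K-clique)
    by-size : k < w ⊎ k ≡ w → LidChromaticAtMost G (2 * w ∸ 1)
    by-size (inj₁ k<w) = CaseA.caseA-lid w k<w (≤-trans (n≤1+n 2) 3≤w)
    by-size (inj₂ k≡w) = CaseB.caseB-lid w ω≡w k≡w (subst (3 ≤_) (≡-sym k≡w) 3≤w)

-- A star with centre z is the split graph ({z}, leaves); if ω(G) ≥ 2 it falls
-- under case A with k = 1, and otherwise it has no edges.
star-lid : ∀ {n} (G : Graph n) w → IsCliqueNumber G w → IsStar G → LidChromaticAtMost G (2 * w ∸ 1)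
star-lid G w ω≡w (z , star) with 2 ≤? w
... | yes 2≤w = CaseA.caseA-lid w (subst (_< w) (≡-sym k≡1) 2≤w) 2≤w
  where
    centre-clique : IsClique G ⁅ z ⁆
    centre-clique u v u∈ v∈ u≢v = ⊥-elim (u≢v (trans (x∈⁅y⁆⇒x≡y z u∈) (≡-sym (x∈⁅y⁆⇒x≡y z v∈))))
    leaves-independent : IsIndependent G (λ v → v ∉ ⁅ z ⁆)
    leaves-independent u v u∉ v∉ u~v with proj₁ (Equivalence.to (star u v) u~v)
    ... | inj₁ refl = u∉ (x∈⁅x⁆ z)
    ... | inj₂ refl = v∉ (x∈⁅x⁆ z)
    open SplitGraph G ⁅ z ⁆ centre-clique leaves-independent
    k≡1 : k ≡ 1
    k≡1 = trans (≡-sym (∣∣≡count ⁅ z ⁆)) (∣⁅x⁆∣≡1 z)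
... | no ¬2≤w = edgeless-lid G (λ u v u~v → ¬2≤w (edge⇒2≤ω u~v)) (below-2w∸1 0 w (*-monoʳ-≤ 2 (vertex⇒1≤ω z)))
  where open CliqueBound G w ω≡w

mainTheorem5 : (n : ℕ) (G : Graph n) (w : ℕ) → IsSplit G → IsCliqueNumber G w →
    (3 ≤ w ⊎ IsStar G) → LidChromaticAtMost G (2 * w ∸ 1)
mainTheorem5 n G w (K , K-clique , S-independent) ω≡w (inj₁ 3≤w) = split-lid G K K-clique S-independent w ω≡w 3≤w
mainTheorem5 n G w _ ω≡w (inj₂ star) = star-lid G w ω≡w star
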